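{- Let $m\ge 1$ and let $C$ be an $m\times n$ binary $2$-covering array with columns $c^1,\dots,c^n$ such that $wt(c^i)\le \lfloor m/2\rfloor$ for all $1\le i\le n$. Put $s=\min_{1\le i\le n} wt(c^i)$. Then for any integer $s'$ with $s< s'\le \lfloor m/2\rfloor$, there is an $m\times n$ binary $2$-covering array $C'$ with columns $c'^1,\dots,c'^n$ such that $s'\le wt(c'^i)\le\lfloor m/2\rfloor$ and $\mathrm{supp}(c^i)\subseteq \mathrm{supp}(c'^i)$ for all $i\in\{1,\dots,n\}$.
   Context: A binary $t$-covering array of size $m$ and degree $n$ is an $m\times n$ matrix with entries in $\{0,1\}$ such that for any $t$ distinct columns, all $2^t$ binary vectors of length $t$ occur at least once as the restriction of some row to those columns. For a binary vector $u$ of length $m$, $\mathrm{supp}(u)=\{i: u_i\neq 0\}$ and $wt(u)=|\mathrm{supp}(u)|$. -}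

module Defs where

open import Data.Nat using (ℕ; zero; suc; _+_; _≤_)
open import Data.Bool using (Bool; true; false)
open import Data.Fin using (Fin; zero; suc)
open import Data.Product using (∃; _×_)
open import Relation.Binary.PropositionalEquality using (_≡_)
open import Relation.Nullary using (¬_)

BinMatrix : ℕ → ℕ → Set
BinMatrix m n = Fin m → Fin n → Bool

wt : {m : ℕ} → (Fin m → Bool) → ℕ
wt {zero}  u = 0
wt {suc m} u with u zero
... | true  = suc (wt (λ r → u (suc r)))
... | false = wt (λ r → u (suc r))

col : {m n : ℕ} → BinMatrix m n → Fin n → (Fin m → Bool)
col C i r = C r i

_⊆supp_ : {m : ℕ} → (Fin m → Bool) → (Fin m → Bool) → Set
_⊆supp_ {m} u v = (r : Fin m) → u r ≡ true → v r ≡ true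

IsCoveringArray2 : {m n : ℕ} → BinMatrix m n → Set
IsCoveringArray2 {m} {n} C =
  (i j : Fin n) → ¬ (i ≡ j) → (a b : Bool) →
  ∃ λ (r : Fin m) → (C r i ≡ a) × (C r j ≡ b)

IsMinColWeight : {m n : ℕ} → BinMatrix m n → ℕ → Set
IsMinColWeight {m} {n} C s =
  (∃ λ (i : Fin n) → wt (col C i) ≡ s) × ((i : Fin n) → s ≤ wt (col C i))

module Submission where

-- Two columns of a binary 2-covering array cover the patterns 10 and 01 exactly
-- when their supports are incomparable, and 11 when the supports meet; if both
-- weights are at most m/2, the pattern 00 then comes for free by counting.
-- So it suffices to enlarge supports while keeping them pairwise incomparable.
--
-- The tool is the bracket-matching injection of the Boolean lattice: reading a
-- vector with 0 as "(" and 1 as ")", flipping the leftmost unmatched 0 adds one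
-- element to the support, and it is injective on vectors having an unmatched 0,
-- which every vector of weight below m/2 has.  Applying it to exactly the
-- columns of minimum weight w < m/2 yields a covering array of minimum weight
-- w + 1 whose supports contain the old ones; iterating reaches any s' ≤ m/2.

open import Defs
open import Data.Nat using (ℕ; zero; suc; _+_; _*_; _≤_; _<_; _/_; z≤n; s≤s; _≟_)
open import Data.Nat.Properties
open import Data.Nat.DivMod using (m/n*n≤m)
open import Algebra.Properties.CommutativeSemigroup +-commutativeSemigroup using (interchange)
open import Data.Fin using (Fin; zero; suc)
open import Data.Fin.Properties using (any?)
open import Data.Bool using (Bool; true; false; not; _∧_)
import Data.Bool.Properties as Bool
open import Data.Product using (∃; _×_; _,_; proj₁; proj₂)
open import Data.Sum using (_⊎_; inj₁; inj₂; [_,_])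
open import Data.Empty using (⊥-elim)
open import Function using (_∘_)
open import Relation.Nullary using (¬_; yes; no; _×-dec_)
open import Relation.Binary.PropositionalEquality hiding ([_])

BitVec : ℕ → Set
BitVec m = Fin m → Bool

tail : ∀ {m} → BitVec (suc m) → BitVec m
tail u r = u (suc r)

cons : ∀ {m} → Bool → BitVec m → BitVec (suc m)
cons b t zero    = b
cons b t (suc r) = t r

true≢false : ¬ true ≡ false
true≢false ()

bit : Bool → ℕ
bit true  = 1
bit false = 0

wt-head : ∀ {m} (u : BitVec (suc m)) → wt u ≡ bit (u zero) + wt (tail u)
wt-head u with u zero
... | true  = refl
... | false = refl

wt-resp : ∀ {m} {u v : BitVec m} → u ≗ v → wt u ≡ wt v
wt-resp {zero}  u≗v = refl
wt-resp {suc m} {u} {v} u≗v = begin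
  wt u                         ≡⟨ wt-head u ⟩
  bit (u zero) + wt (tail u)   ≡⟨ cong₂ _+_ (cong bit (u≗v zero)) (wt-resp (u≗v ∘ suc)) ⟩
  bit (v zero) + wt (tail v)   ≡⟨ sym (wt-head v) ⟩
  wt v                         ∎
  where open ≡-Reasoning

wt-false : ∀ {m} → wt {m} (λ _ → false) ≡ 0
wt-false {zero}  = refl
wt-false {suc m} = wt-false {m}

wt-true : ∀ {m} → wt {m} (λ _ → true) ≡ m
wt-true {zero}  = refl
wt-true {suc m} = cong suc (wt-true {m})

wt-pos : ∀ {m} (u : BitVec m) (r : Fin m) → u r ≡ true → 0 < wt u
wt-pos u zero    ur rewrite wt-head u | ur = s≤s z≤n
wt-pos u (suc r) ur rewrite wt-head u = ≤-trans (wt-pos (tail u) r ur) (m≤n+m _ (bit (u zero)))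

wt-pointwise : ∀ {m} (u v x y : BitVec m) →
  (∀ r → bit (u r) + bit (v r) ≡ bit (x r) + bit (y r)) → wt u + wt v ≡ wt x + wt y
wt-pointwise {zero}  u v x y eq = refl
wt-pointwise {suc m} u v x y eq = begin
  wt u + wt v                      ≡⟨ cong₂ _+_ (wt-head u) (wt-head v) ⟩
  (bu + wt u′) + (bv + wt v′)      ≡⟨ interchange bu (wt u′) bv (wt v′) ⟩
  (bu + bv) + (wt u′ + wt v′)      ≡⟨ cong₂ _+_ (eq zero) (wt-pointwise u′ v′ x′ y′ (eq ∘ suc)) ⟩
  (bx + by) + (wt x′ + wt y′)      ≡⟨ interchange bx by (wt x′) (wt y′) ⟩
  (bx + wt x′) + (by + wt y′)      ≡⟨ sym (cong₂ _+_ (wt-head x) (wt-head y)) ⟩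
  wt x + wt y                      ∎
  where
  open ≡-Reasoning
  bu bv bx by : ℕ
  bu = bit (u zero)
  bv = bit (v zero)
  bx = bit (x zero)
  by = bit (y zero)
  u′ v′ x′ y′ : BitVec m
  u′ = tail u
  v′ = tail v
  x′ = tail x
  y′ = tail y

-- A proper inclusion of supports strictly increases the weight:
-- wt v = wt u + wt (v ∖ u), and v ∖ u is nonzero.
wt-proper : ∀ {m} (u v : BitVec m) → u ⊆supp v →
  (r : Fin m) → v r ≡ true → u r ≡ false → wt u < wt v
wt-proper {m} u v u⊆v r vr ur = begin-strict
  wt u                       <⟨ m<m+n (wt u) (wt-pos v∖u r (cong₂ _∧_ vr (cong not ur))) ⟩
  wt u + wt v∖u              ≡⟨ wt-pointwise u v∖u v (λ _ → false) split ⟩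
  wt v + wt {m} (λ _ → false) ≡⟨ cong (wt v +_) (wt-false {m}) ⟩
  wt v + 0                   ≡⟨ +-identityʳ (wt v) ⟩
  wt v                       ∎
  where
  open ≤-Reasoning
  v∖u : BitVec m
  v∖u s = v s ∧ not (u s)
  bits : ∀ a b → (a ≡ true → b ≡ true) → bit a + bit (b ∧ not a) ≡ bit b + 0
  bits true  true  _ = refl
  bits true  false f = ⊥-elim (true≢false (sym (f refl)))
  bits false true  _ = refl
  bits false false _ = refl
  split : ∀ s → bit (u s) + bit (v∖u s) ≡ bit (v s) + bit false
  split s = bits (u s) (v s) (u⊆v s)

⊆supp-by-wt : ∀ {m} (u v : BitVec m) → u ⊆supp v → wt v ≤ wt u → v ⊆supp u
⊆supp-by-wt u v u⊆v wv≤wu r vr with u r in ur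
... | true  = refl
... | false = ⊥-elim (<⇒≱ (wt-proper u v u⊆v r vr ur) wv≤wu)

⊆supp-antisym : ∀ {m} {u v : BitVec m} → u ⊆supp v → v ⊆supp u → u ≗ v
⊆supp-antisym {u = u} {v} u⊆v v⊆u r with u r in ur | v r in vr
... | true  | true  = refl
... | true  | false = ⊥-elim (true≢false (trans (sym (u⊆v r ur)) vr))
... | false | true  = ⊥-elim (true≢false (trans (sym (v⊆u r vr)) ur))
... | false | false = refl

wt-cover : ∀ {m} (u v : BitVec m) → (∀ r → ¬ (u r ≡ false × v r ≡ false)) →
  (∃ λ r → u r ≡ true × v r ≡ true) → m < wt u + wt v
wt-cover {m} u v no00 (r , ur , vr) = begin-strict
  m                          <⟨ m<m+n m (wt-pos u∧v r (cong₂ _∧_ ur vr)) ⟩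
  m + wt u∧v                 ≡⟨ cong (_+ wt u∧v) (sym wt-true) ⟩
  wt {m} (λ _ → true) + wt u∧v ≡⟨ sym (wt-pointwise u v (λ _ → true) u∧v rowwise) ⟩
  wt u + wt v                ∎
  where
  open ≤-Reasoning
  u∧v : BitVec m
  u∧v s = u s ∧ v s
  bits : ∀ a b → ¬ (a ≡ false × b ≡ false) → bit a + bit b ≡ 1 + bit (a ∧ b)
  bits true  true  _ = refl
  bits true  false _ = refl
  bits false true  _ = refl
  bits false false f = ⊥-elim (f (refl , refl))
  rowwise : ∀ s → bit (u s) + bit (v s) ≡ bit true + bit (u∧v s)
  rowwise s = bits (u s) (v s) (no00 s)

covering⇒incomparable : ∀ {m n} {C : BinMatrix m n} → IsCoveringArray2 C →
  ∀ {i j} → ¬ i ≡ j → ¬ (col C i ⊆supp col C j)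
covering⇒incomparable cov i≢j i⊆j with cov _ _ i≢j true false
... | r , ir , jr = Bool.not-¬ (i⊆j r ir) jr

covering-criterion : ∀ {m n} (C : BinMatrix m n) →
  (∀ i j → ¬ i ≡ j → ¬ (col C i ⊆supp col C j)) →
  (∀ i j → ¬ i ≡ j → ∃ λ r → C r i ≡ true × C r j ≡ true) →
  (∀ i j → wt (col C i) + wt (col C j) ≤ m) →
  IsCoveringArray2 C
covering-criterion {m} C incomparable meet small i j i≢j a b
  with any? (λ r → (C r i Bool.≟ a) ×-dec (C r j Bool.≟ b))
... | yes found = found
... | no none = absent a b nowhere
  where
  nowhere : ∀ r → ¬ (C r i ≡ a × C r j ≡ b)
  nowhere r p = none (r , p)
  absent : ∀ a b → (∀ r → ¬ (C r i ≡ a × C r j ≡ b)) → ∃ λ r → C r i ≡ a × C r j ≡ b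
  absent true  true  _ = meet i j i≢j
  absent true  false h = ⊥-elim (incomparable i j i≢j λ r ir → Bool.¬-not λ jr → h r (ir , jr))
  absent false true  h =
    ⊥-elim (incomparable j i (i≢j ∘ sym) λ r jr → Bool.¬-not λ ir → h r (ir , jr))
  absent false false h = ⊥-elim (<⇒≱ (wt-cover (col C i) (col C j) h (meet i j i≢j)) (small i j))

-- Read with 0 as "(" and 1 as ")", a 0 at position p can be
-- matched with a 1 at a later position.  unmatched1 u and unmatched0 u count the
-- unmatched 1s and 0s; both are computed from the last position backwards.
unmatched1-step : Bool → ℕ → ℕ
unmatched1-step true  a       = suc a
unmatched1-step false zero    = zero
unmatched1-step false (suc a) = a

unmatched1 : ∀ {m} → BitVec m → ℕ
unmatched1 {zero}  u = 0
unmatched1 {suc m} u = unmatched1-step (u zero) (unmatched1 (tail u))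

unmatched1-resp : ∀ {m} {u v : BitVec m} → u ≗ v → unmatched1 u ≡ unmatched1 v
unmatched1-resp {zero}  u≗v = refl
unmatched1-resp {suc m} u≗v = cong₂ unmatched1-step (u≗v zero) (unmatched1-resp (u≗v ∘ suc))

unmatched0-step : Bool → ℕ → ℕ → ℕ
unmatched0-step true  a       z = z
unmatched0-step false zero    z = suc z
unmatched0-step false (suc a) z = z

unmatched0 : ∀ {m} → BitVec m → ℕ
unmatched0 {zero}  u = 0
unmatched0 {suc m} u = unmatched0-step (u zero) (unmatched1 (tail u)) (unmatched0 (tail u))

-- Each matched pair uses one 0 and one 1, so (unmatched 0s) + 2·wt = (unmatched 1s) + m.
balance : ∀ {m} (u : BitVec m) → unmatched0 u + (wt u + wt u) ≡ unmatched1 u + m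
balance {zero}  u = refl
balance {suc m} u =
  trans (cong (λ x → unmatched0 u + (x + x)) (wt-head u))
        (balance-step (u zero) (unmatched1 (tail u)) (unmatched0 (tail u)) (wt (tail u)) (balance (tail u)))
  where
  balance-step : ∀ b a z w → z + (w + w) ≡ a + m →
    unmatched0-step b a z + ((bit b + w) + (bit b + w)) ≡ unmatched1-step b a + suc m
  balance-step true a z w e = begin
    z + (suc w + suc w)       ≡⟨ cong (λ x → z + suc x) (+-suc w w) ⟩
    z + suc (suc (w + w))     ≡⟨ +-suc z _ ⟩
    suc (z + suc (w + w))     ≡⟨ cong suc (+-suc z _) ⟩
    suc (suc (z + (w + w)))   ≡⟨ cong (λ x → suc (suc x)) e ⟩
    suc (suc (a + m))         ≡⟨ cong suc (sym (+-suc a m)) ⟩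
    suc (a + suc m)           ∎
    where open ≡-Reasoning
  balance-step false zero    z w e = cong suc e
  balance-step false (suc a) z w e = trans e (sym (+-suc a m))

unmatched0-pos : ∀ {m} (u : BitVec m) → wt u + wt u < m → 0 < unmatched0 u
unmatched0-pos {m} u light with unmatched0 u | balance u
... | zero  | eq = ⊥-elim (<⇒≱ light (≤-trans (m≤n+m m (unmatched1 u)) (≤-reflexive (sym eq))))
... | suc z | _  = s≤s z≤n

-- raise u flips the leftmost unmatched 0 of u (and is the identity if there is
-- none).  raise-cons b a t is raise (cons b t), given a = unmatched1 t: a head 0
-- is unmatched exactly when a = 0, otherwise the flip happens in the tail.
mutual
  raise : ∀ {m} → BitVec m → BitVec m
  raise {zero}  u = u
  raise {suc m} u = raise-cons (u zero) (unmatched1 (tail u)) (tail u)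

  raise-cons : ∀ {m} → Bool → ℕ → BitVec m → BitVec (suc m)
  raise-cons false zero    t = cons true t
  raise-cons false (suc a) t = cons false (raise t)
  raise-cons true  a       t = cons true (raise t)

cons-head-tail : ∀ {m} (u : BitVec (suc m)) → cons (u zero) (tail u) ≗ u
cons-head-tail u zero    = refl
cons-head-tail u (suc r) = refl

mutual
  raise-⊇ : ∀ {m} (u : BitVec m) → u ⊆supp raise u
  raise-⊇ {suc m} u r ur =
    raise-cons-⊇ (u zero) (unmatched1 (tail u)) (tail u) r (trans (cons-head-tail u r) ur)

  raise-cons-⊇ : ∀ {m} b a (t : BitVec m) → cons b t ⊆supp raise-cons b a t
  raise-cons-⊇ false zero    t zero    ur = refl
  raise-cons-⊇ false zero    t (suc r) ur = ur
  raise-cons-⊇ false (suc a) t zero    ur = ur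
  raise-cons-⊇ false (suc a) t (suc r) ur = raise-⊇ t r ur
  raise-cons-⊇ true  a       t zero    ur = refl
  raise-cons-⊇ true  a       t (suc r) ur = raise-⊇ t r ur

mutual
  raise-wt : ∀ {m} (u : BitVec m) → 0 < unmatched0 u → wt (raise u) ≡ suc (wt u)
  raise-wt {suc m} u h =
    trans (raise-cons-wt (u zero) (unmatched1 (tail u)) (tail u) h) (cong suc (sym (wt-head u)))

  raise-cons-wt : ∀ {m} b a (t : BitVec m) → 0 < unmatched0-step b a (unmatched0 t) →
    wt (raise-cons b a t) ≡ suc (bit b + wt t)
  raise-cons-wt false zero    t h = refl
  raise-cons-wt false (suc a) t h = raise-wt t h
  raise-cons-wt true  a       t h = cong suc (raise-wt t h)

-- The flipped 0 becomes an unmatched 1.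
mutual
  raise-unmatched1 : ∀ {m} (u : BitVec m) → 0 < unmatched0 u →
    unmatched1 (raise u) ≡ suc (unmatched1 u)
  raise-unmatched1 {suc m} u h = raise-cons-unmatched1 (u zero) (unmatched1 (tail u)) (tail u) refl h

  raise-cons-unmatched1 : ∀ {m} b a (t : BitVec m) → a ≡ unmatched1 t →
    0 < unmatched0-step b a (unmatched0 t) → unmatched1 (raise-cons b a t) ≡ suc (unmatched1-step b a)
  raise-cons-unmatched1 false zero    t e h = cong suc (sym e)
  raise-cons-unmatched1 false (suc a) t e h =
    cong (unmatched1-step false) (trans (raise-unmatched1 t h) (cong suc (sym e)))
  raise-cons-unmatched1 true  a       t e h = cong suc (trans (raise-unmatched1 t h) (cong suc (sym e)))

-- Raising is injective on vectors with an unmatched 0.  Equal heads reduce to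
-- the tails; if one vector flips its head while the other keeps a head 1, the
-- tails satisfy t = raise t', which has an unmatched 1, contradicting that the
-- flipped head 0 was unmatched.
mutual
  raise-injective : ∀ {m} (u v : BitVec m) → 0 < unmatched0 u → 0 < unmatched0 v →
    raise u ≗ raise v → u ≗ v
  raise-injective {suc m} u v hu hv eq r = begin
    u r                            ≡⟨ sym (cons-head-tail u r) ⟩
    cons (u zero) (tail u) r       ≡⟨ raise-cons-injective (u zero) (unmatched1 (tail u)) (tail u)
                                        (v zero) (unmatched1 (tail v)) (tail v) refl refl hu hv eq r ⟩
    cons (v zero) (tail v) r       ≡⟨ cons-head-tail v r ⟩
    v r                            ∎
    where open ≡-Reasoning

  raise-cons-injective : ∀ {m} b a (t : BitVec m) b' a' t' →
    a ≡ unmatched1 t → a' ≡ unmatched1 t' →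
    0 < unmatched0-step b a (unmatched0 t) → 0 < unmatched0-step b' a' (unmatched0 t') →
    raise-cons b a t ≗ raise-cons b' a' t' → cons b t ≗ cons b' t'
  raise-cons-injective false zero    t false zero     t' _ _  _  _  eq zero    = refl
  raise-cons-injective false zero    t false zero     t' _ _  _  _  eq (suc r) = eq (suc r)
  raise-cons-injective false zero    t false (suc a') t' _ _  _  _  eq r       = ⊥-elim (true≢false (eq zero))
  raise-cons-injective false zero    t true  a'       t' e _  _  hv eq r       =
    ⊥-elim (0≢1+n (trans e (trans (unmatched1-resp (eq ∘ suc)) (raise-unmatched1 t' hv))))
  raise-cons-injective false (suc a) t false zero     t' _ _  _  _  eq r       = ⊥-elim (true≢false (sym (eq zero)))
  raise-cons-injective false (suc a) t false (suc a') t' _ _  _  _  eq zero    = refl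
  raise-cons-injective false (suc a) t false (suc a') t' _ _  hu hv eq (suc r) = raise-injective t t' hu hv (eq ∘ suc) r
  raise-cons-injective false (suc a) t true  a'       t' _ _  _  _  eq r       = ⊥-elim (true≢false (sym (eq zero)))
  raise-cons-injective true  a       t false zero     t' _ e' hu _  eq r       =
    ⊥-elim (0≢1+n (trans e' (trans (unmatched1-resp (sym ∘ eq ∘ suc)) (raise-unmatched1 t hu))))
  raise-cons-injective true  a       t false (suc a') t' _ _  _  _  eq r       = ⊥-elim (true≢false (eq zero))
  raise-cons-injective true  a       t true  a'       t' _ _  _  _  eq zero    = refl
  raise-cons-injective true  a       t true  a'       t' _ _  hu hv eq (suc r) = raise-injective t t' hu hv (eq ∘ suc) r

lift : ∀ {m} → ℕ → BitVec m → BitVec m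
lift w u with wt u ≟ w
... | yes _ = raise u
... | no  _ = u

lift-⊇ : ∀ {m} w (u : BitVec m) → u ⊆supp lift w u
lift-⊇ w u with wt u ≟ w
... | yes _ = raise-⊇ u
... | no  _ = λ r ur → ur

raisable : ∀ {m} {w} (u : BitVec m) → w + w < m → wt u ≡ w → 0 < unmatched0 u
raisable u light refl = unmatched0-pos u light

raise-wt-light : ∀ {m} {w} (u : BitVec m) → w + w < m → wt u ≡ w → wt (raise u) ≡ suc w
raise-wt-light u light u≡w = trans (raise-wt u (raisable u light u≡w)) (cong suc u≡w)

lift-wt : ∀ {m} {w k} (u : BitVec m) → w + w < m → w < k → w ≤ wt u → wt u ≤ k →
  suc w ≤ wt (lift w u) × wt (lift w u) ≤ k
lift-wt {w = w} u light w<k w≤u u≤k with wt u ≟ w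
... | yes u≡w = ≤-reflexive (sym raised) , subst (_≤ _) (sym raised) w<k
  where
  raised : wt (raise u) ≡ suc w
  raised = raise-wt-light u light u≡w
... | no  u≢w = ≤∧≢⇒< w≤u (u≢w ∘ sym) , u≤k

lift-comparable : ∀ {m} {w} (u v : BitVec m) → w + w < m → w ≤ wt u →
  lift w u ⊆supp lift w v → u ⊆supp v ⊎ v ⊆supp u
lift-comparable {w = w} u v light w≤u sub with wt u ≟ w | wt v ≟ w
... | no  _   | no  _   = inj₁ sub
... | yes _   | no  _   = inj₁ λ r ur → sub r (raise-⊇ u r ur)
... | no  u≢w | yes v≡w = inj₂ λ r vr → raise-v⊆u r (raise-⊇ v r vr)
  where
  raise-v⊆u : raise v ⊆supp u
  raise-v⊆u = ⊆supp-by-wt u (raise v) sub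
    (subst (_≤ wt u) (sym (raise-wt-light v light v≡w)) (≤∧≢⇒< w≤u (u≢w ∘ sym)))
... | yes u≡w | yes v≡w = inj₁ λ r ur → trans (sym (u≗v r)) ur
  where
  raises-equal : raise u ≗ raise v
  raises-equal = ⊆supp-antisym sub (⊆supp-by-wt (raise u) (raise v) sub
    (≤-reflexive (trans (raise-wt-light v light v≡w) (sym (raise-wt-light u light u≡w)))))
  u≗v : u ≗ v
  u≗v = raise-injective u v (raisable u light u≡w) (raisable v light v≡w) raises-equal

Enlargement : ∀ {m n} → ℕ → ℕ → BinMatrix m n → Set
Enlargement {m} {n} t k C = ∃ λ (C' : BinMatrix m n) → IsCoveringArray2 C' ×
  ((i : Fin n) → (t ≤ wt (col C' i)) × (wt (col C' i) ≤ k) × (col C i ⊆supp col C' i))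

raise-min-weight : ∀ {m n} k → k + k ≤ m → (w : ℕ) → w < k →
  (C : BinMatrix m n) → IsCoveringArray2 C →
  ((i : Fin n) → w ≤ wt (col C i) × wt (col C i) ≤ k) → Enlargement (suc w) k C
raise-min-weight {m} {n} k k+k≤m w w<k C cov bounds =
  C' , covering-criterion C' incomparable meet small ,
  λ i → proj₁ (new-wt i) , proj₂ (new-wt i) , lift-⊇ w (col C i)
  where
  light : w + w < m
  light = <-≤-trans (+-mono-< w<k w<k) k+k≤m
  C' : BinMatrix m n
  C' r i = lift w (col C i) r
  new-wt : ∀ i → suc w ≤ wt (col C' i) × wt (col C' i) ≤ k
  new-wt i = lift-wt (col C i) light w<k (proj₁ (bounds i)) (proj₂ (bounds i))
  incomparable : ∀ i j → ¬ i ≡ j → ¬ (col C' i ⊆supp col C' j)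
  incomparable i j i≢j sub =
    [ covering⇒incomparable cov i≢j , covering⇒incomparable cov (i≢j ∘ sym) ]
      (lift-comparable (col C i) (col C j) light (proj₁ (bounds i)) sub)
  meet : ∀ i j → ¬ i ≡ j → ∃ λ r → C' r i ≡ true × C' r j ≡ true
  meet i j i≢j with cov i j i≢j true true
  ... | r , ir , jr = r , lift-⊇ w (col C i) r ir , lift-⊇ w (col C j) r jr
  small : ∀ i j → wt (col C' i) + wt (col C' j) ≤ m
  small i j = ≤-trans (+-mono-≤ (proj₂ (new-wt i)) (proj₂ (new-wt j))) k+k≤m

raise-weights-to : ∀ {m n} k → k + k ≤ m → (t : ℕ) → t ≤ k →
  (C : BinMatrix m n) → IsCoveringArray2 C → ((i : Fin n) → wt (col C i) ≤ k) → Enlargement t k C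
raise-weights-to k k+k≤m zero _ C cov wt≤k = C , cov , λ i → z≤n , wt≤k i , λ r ur → ur
raise-weights-to k k+k≤m (suc t) t<k C cov wt≤k
  with raise-weights-to k k+k≤m t (<⇒≤ t<k) C cov wt≤k
... | C₁ , cov₁ , b₁
  with raise-min-weight k k+k≤m t t<k C₁ cov₁ (λ i → let (t≤wt , wt≤k , _) = b₁ i in t≤wt , wt≤k)
... | C₂ , cov₂ , b₂ = C₂ , cov₂ , λ i →
  let (_ , _ , C⊆C₁) = b₁ i ; (t<wt , wt≤k , C₁⊆C₂) = b₂ i
  in  t<wt , wt≤k , λ r → C₁⊆C₂ r ∘ C⊆C₁ r

half+half≤ : ∀ m → m / 2 + m / 2 ≤ m
half+half≤ m = begin
  m / 2 + m / 2        ≡⟨ cong (m / 2 +_) (sym (+-identityʳ (m / 2))) ⟩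
  2 * (m / 2)          ≡⟨ *-comm 2 (m / 2) ⟩
  m / 2 * 2            ≤⟨ m/n*n≤m m 2 ⟩
  m                    ∎
  where open ≤-Reasoning

-- The theorem holds for every target s' ≤ m/2.
lemma3p1 : (m n : ℕ) → 1 ≤ m → (C : BinMatrix m n) → IsCoveringArray2 C →
    ((i : Fin n) → wt (col C i) ≤ m / 2) →
    (s : ℕ) → IsMinColWeight C s →
    (s' : ℕ) → s < s' → s' ≤ m / 2 →
    ∃ λ (C' : BinMatrix m n) → IsCoveringArray2 C' ×
    ((i : Fin n) → (s' ≤ wt (col C' i)) × (wt (col C' i) ≤ m / 2) × (col C i ⊆supp col C' i))
lemma3p1 m n _ C cov wt≤half _ _ s' _ s'≤half =
  raise-weights-to (m / 2) (half+half≤ m) s' s'≤half C cov wt≤half
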